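{- Let $k\ge 4$ be an integer and let $G$ be a graph with $m(G)<m_2(K_k)$. Then $G\not\to\mathrm{TT}_k$, i.e., $G$ has an orientation containing no copy of $\mathrm{TT}_k$.
   Context: $\mathrm{TT}_k$ is the transitive tournament on $k$ vertices. $m(G)=\max\{e(J)/v(J):J\subseteq G,\ v(J)\ge1\}$ and $m_2(G)=\max\{(e(J)-1)/(v(J)-2):J\subseteq G,\ v(J)\ge3\}$ (so $m_2(K_k)=(k+1)/2$). -}

module Defs where

open import Data.Nat using (ℕ; zero; suc; _+_; _*_; _<_; _≤_; _<ᵇ_)
open import Data.Fin using (Fin; toℕ) renaming (zero to fzero; suc to fsuc)
open import Data.Bool using (Bool; true; false; if_then_else_; _∧_)
open import Data.Product using (Σ; _×_)
open import Data.Sum using (_⊎_)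
open import Relation.Binary.PropositionalEquality using (_≡_)
open import Function.Definitions using (Injective)

record Graph (n : ℕ) : Set where
  field
    adj    : Fin n → Fin n → Bool
    sym    : ∀ i j → adj i j ≡ adj j i
    irrefl : ∀ i → adj i i ≡ false
open Graph public

countFin : ∀ {n} → (Fin n → Bool) → ℕ
countFin {zero}  f = 0
countFin {suc n} f = (if f fzero then 1 else 0) + countFin (λ i → f (fsuc i))

record Subgraph {n : ℕ} (G : Graph n) : Set where
  field
    vs     : Fin n → Bool
    es     : Fin n → Fin n → Bool
    es-sym : ∀ i j → es i j ≡ es j i
    es-sub : ∀ i j → es i j ≡ true →
             (adj G i j ≡ true) × (vs i ≡ true) × (vs j ≡ true)
open Subgraph public

vJ : ∀ {n} {G : Graph n} → Subgraph G → ℕ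
vJ J = countFin (vs J)

sumFin : ∀ {n} → (Fin n → ℕ) → ℕ
sumFin {zero}  f = 0
sumFin {suc n} f = f fzero + sumFin (λ i → f (fsuc i))

eJ : ∀ {n} {G : Graph n} → Subgraph G → ℕ
eJ J = sumFin (λ i → countFin (λ j → (toℕ i <ᵇ toℕ j) ∧ es J i j))

-- m(G) < p / q   (q > 0):  every subgraph J with v(J) ≥ 1 has e(J)/v(J) < p/q,
-- i.e. q·e(J) < p·v(J).  (The max over the finite set of subgraphs is < p/q
-- iff each ratio is.)
mBelow : ∀ {n} → Graph n → (p q : ℕ) → Set
mBelow G p q = ∀ (J : Subgraph G) → 1 ≤ vJ J → q * eJ J < p * vJ J

record Orientation {n : ℕ} (G : Graph n) : Set where
  field
    arc       : Fin n → Fin n → Bool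
    arc-edge  : ∀ i j → arc i j ≡ true → adj G i j ≡ true
    arc-total : ∀ i j → adj G i j ≡ true → (arc i j ≡ true) ⊎ (arc j i ≡ true)
    arc-anti  : ∀ i j → arc i j ≡ true → arc j i ≡ false
open Orientation public

-- D contains a copy of TT_k: an injective map of the vertices 0 < 1 < ... < k-1
-- of TT_k (arcs a → b for a < b) preserving all arcs.
ContainsTT : ∀ {n} {G : Graph n} → ℕ → Orientation G → Set
ContainsTT {n} k D =
  Σ (Fin k → Fin n) λ f →
    Injective _≡_ _≡_ f × (∀ a b → toℕ a < toℕ b → arc D (f a) (f b) ≡ true)

-- Since m(G) < (k+1)/2, every nonempty induced subgraph has average degree below k + 1,
-- hence a vertex v of degree at most k. Orient G[A - v] without TT_k recursively and
-- orient each edge vy towards y iff y has at least k - 2 out-neighbours in N(v).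
-- A transitive tournament through v then needs v to be both its source (the first other
-- vertex has k - 2 out-neighbours in N(v), so it points to v unless v comes first) and
-- its sink (the last other vertex has at most |N(v)| - (k - 1) ≤ 1 out-neighbours there),
-- which is impossible for k ≥ 4.
module Submission where

open import Defs hiding (sym)
open import Data.Bool using (Bool; true; false; if_then_else_; _∧_; not)
open import Data.Bool.Properties using (∧-conicalˡ; ∧-conicalʳ; ∧-zeroʳ; not-injective)
open import Data.Empty using (⊥; ⊥-elim)
open import Data.Fin using (Fin; toℕ; fromℕ; punchIn; _≟_) renaming (zero to fzero; suc to fsuc)
open import Data.Fin.Properties
  using (any?; toℕ-injective; suc-injective; punchInᵢ≢i; punchIn-injective; ≤fromℕ)
  renaming (<-cmp to <-cmpᶠ; ≤∧≢⇒< to ≤∧≢⇒<ᶠ)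
open import Data.Nat using (ℕ; zero; suc; _+_; _*_; _≤_; _<_; _<ᵇ_; z≤n; s≤s; s≤s⁻¹; z<s; s<s)
open import Data.Nat.Properties
  using (+-0-commutativeMonoid; _<?_; _≤?_; <-cmp; <-irrefl; ≤-refl; ≤-trans; ≤⇒≯; ≰⇒>;
         +-identityʳ; +-mono-≤; +-monoʳ-≤; +-cancelʳ-≤; m≤n+m; *-suc; *-zeroʳ; module ≤-Reasoning)
open import Algebra.Properties.CommutativeMonoid.Sum +-0-commutativeMonoid
  using (sum-syntax; ∑-distrib-+; ∑-comm; sum-cong-≗)
open import Data.Product using (Σ; ∃; _×_; _,_; proj₁; proj₂)
open import Data.Sum using (_⊎_; inj₁; inj₂) renaming (swap to ⊎-swap)
open import Function using (_∘_)
open import Function.Definitions using (Injective)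
open import Relation.Binary.Definitions using (tri<; tri≈; tri>)
open import Relation.Binary.PropositionalEquality
  using (_≡_; _≢_; refl; sym; trans; cong; cong₂; subst; module ≡-Reasoning)
open import Relation.Nullary using (¬_; yes; no; does)
open import Relation.Nullary.Decidable using (dec-true; dec-false; _×-dec_)

private
  variable
    m n : ℕ

indicator : Bool → ℕ
indicator b = if b then 1 else 0

∧-true : ∀ {a b} → a ≡ true → b ≡ true → a ∧ b ≡ true
∧-true refl refl = refl

∧-true-or-∧-not : ∀ {a} → a ≡ true → ∀ b → (a ∧ b ≡ true) ⊎ (a ∧ not b ≡ true)
∧-true-or-∧-not refl true  = inj₁ refl
∧-true-or-∧-not refl false = inj₂ refl

∧-true⁻ : ∀ {a b} → a ∧ b ≡ true → a ≡ true × b ≡ true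
∧-true⁻ {true} {true} _ = refl , refl

true≢false : true ≢ false
true≢false ()

countFin-sum : (P : Fin n → Bool) → countFin P ≡ ∑[ i < n ] indicator (P i)
countFin-sum {zero}  P = refl
countFin-sum {suc n} P = cong (indicator (P fzero) +_) (countFin-sum (P ∘ fsuc))

sumFin-sum : (f : Fin n → ℕ) → sumFin f ≡ ∑[ i < n ] f i
sumFin-sum {zero}  f = refl
sumFin-sum {suc n} f = cong (f fzero +_) (sumFin-sum (f ∘ fsuc))

countFin-+ : (P Q R : Fin n → Bool) →
             (∀ i → indicator (P i) ≡ indicator (Q i) + indicator (R i)) →
             countFin P ≡ countFin Q + countFin R
countFin-+ {n} P Q R split = begin
  countFin P                                                 ≡⟨ countFin-sum P ⟩
  ∑[ i < n ] indicator (P i)                                 ≡⟨ sum-cong-≗ split ⟩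
  ∑[ i < n ] (indicator (Q i) + indicator (R i))             ≡⟨ ∑-distrib-+ (indicator ∘ Q) (indicator ∘ R) ⟩
  ∑[ i < n ] indicator (Q i) + ∑[ i < n ] indicator (R i)   ≡⟨ cong₂ _+_ (countFin-sum Q) (countFin-sum R) ⟨
  countFin Q + countFin R                                    ∎
  where open ≡-Reasoning

countFin-∧-not : (P Q : Fin n → Bool) →
                 countFin P ≡ countFin (λ i → P i ∧ Q i) + countFin (λ i → P i ∧ not (Q i))
countFin-∧-not P Q = countFin-+ _ _ _ (λ i → split (P i) (Q i))
  where
  split : ∀ a b → indicator a ≡ indicator (a ∧ b) + indicator (a ∧ not b)
  split false _     = refl
  split true  true  = refl
  split true  false = refl

remove : (Fin n → Bool) → Fin n → Fin n → Bool
remove A x y = if does (y ≟ x) then false else A y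

remove-≢ : (A : Fin n → Bool) {x y : Fin n} → y ≢ x → remove A x y ≡ A y
remove-≢ A {x} {y} y≢x rewrite dec-false (y ≟ x) y≢x = refl

countFin-remove : (A : Fin n → Bool) {x : Fin n} → A x ≡ true →
                  countFin A ≡ suc (countFin (remove A x))
countFin-remove A {fzero}  Ax rewrite Ax = refl
countFin-remove A {fsuc x} Ax with A fzero
... | true  = cong suc (countFin-remove (A ∘ fsuc) Ax)
... | false = countFin-remove (A ∘ fsuc) Ax

countFin>0 : (A : Fin n → Bool) {x : Fin n} → A x ≡ true → 0 < countFin A
countFin>0 A Ax = subst (0 <_) (sym (countFin-remove A Ax)) z<s

injective⇒≤countFin : (f : Fin m → Fin n) → Injective _≡_ _≡_ f → (P : Fin n → Bool) →
                      (∀ i → P (f i) ≡ true) → m ≤ countFin P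
injective⇒≤countFin {zero}  f f-inj P Pf = z≤n
injective⇒≤countFin {suc m} f f-inj P Pf =
  subst (suc m ≤_) (sym (countFin-remove P (Pf fzero)))
    (s≤s (injective⇒≤countFin (f ∘ fsuc) (suc-injective ∘ f-inj) (remove P (f fzero))
            (λ i → trans (remove-≢ P (λ eq → fsuc≢fzero (f-inj eq))) (Pf (fsuc i)))))
  where
  fsuc≢fzero : ∀ {i : Fin m} → fsuc i ≢ fzero
  fsuc≢fzero ()

*-countFin≤sumFin : (A : Fin n → Bool) (f : Fin n → ℕ) (c : ℕ) →
                    (∀ i → A i ≡ true → c ≤ f i) → c * countFin A ≤ sumFin f
*-countFin≤sumFin {zero}  A f c bound = subst (_≤ 0) (sym (*-zeroʳ c)) z≤n
*-countFin≤sumFin {suc n} A f c bound with A fzero in A0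
... | true  = subst (_≤ sumFin f) (sym (*-suc c _))
                (+-mono-≤ (bound fzero A0) (*-countFin≤sumFin (A ∘ fsuc) (f ∘ fsuc) c (bound ∘ fsuc)))
... | false = ≤-trans (*-countFin≤sumFin (A ∘ fsuc) (f ∘ fsuc) c (bound ∘ fsuc)) (m≤n+m _ (f fzero))

-- The vertices outside A are kept, as isolated vertices.
_[_] : Graph n → (Fin n → Bool) → Graph n
G [ A ] = record { adj = adjA ; sym = adjA-sym ; irrefl = adjA-irrefl }
  where
  adjA : _ → _ → Bool
  adjA i j = A i ∧ (A j ∧ adj G i j)

  adjA-sym : ∀ i j → adjA i j ≡ adjA j i
  adjA-sym i j rewrite Graph.sym G i j with A i | A j
  ... | true  | true  = refl
  ... | true  | false = refl
  ... | false | true  = refl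
  ... | false | false = refl

  adjA-irrefl : ∀ i → adjA i i ≡ false
  adjA-irrefl i rewrite irrefl G i | ∧-zeroʳ (A i) | ∧-zeroʳ (A i) = refl

no-loop : (G : Graph n) (i : Fin n) → adj G i i ≢ true
no-loop G i loop = true≢false (trans (sym loop) (irrefl G i))

degree : Graph n → Fin n → ℕ
degree G v = countFin (adj G v)

induced-remove : (G : Graph n) (A : Fin n → Bool) {v x y : Fin n} → x ≢ v → y ≢ v →
                 adj (G [ remove A v ]) x y ≡ adj (G [ A ]) x y
induced-remove G A x≢v y≢v rewrite remove-≢ A x≢v | remove-≢ A y≢v = refl

inducedSubgraph : (G : Graph n) → (Fin n → Bool) → Subgraph G
inducedSubgraph G A = record
  { vs     = A
  ; es     = adj (G [ A ])
  ; es-sym = Graph.sym (G [ A ])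
  ; es-sub = λ i j e → let Ai , Aj∧ij = ∧-true⁻ e; Aj , ij = ∧-true⁻ Aj∧ij in ij , Ai , Aj
  }

es-irrefl : {G : Graph n} (J : Subgraph G) (i : Fin n) → es J i i ≡ false
es-irrefl {G = G} J i with es J i i in e
... | true  = ⊥-elim (no-loop G i (proj₁ (es-sub J i i e)))
... | false = refl

handshake : {G : Graph n} (J : Subgraph G) → sumFin (λ i → countFin (es J i)) ≡ 2 * eJ J
handshake {n} J = begin
  sumFin (λ i → countFin (es J i))                  ≡⟨ sum-of-counts (es J) ⟩
  ∑[ i < n ] ∑[ j < n ] indicator (es J i j)        ≡⟨ sum-cong-≗ (λ i → sum-cong-≗ (split i)) ⟩
  ∑[ i < n ] ∑[ j < n ] (up i j + up j i)           ≡⟨ sum-cong-≗ (λ i → ∑-distrib-+ (up i) (λ j → up j i)) ⟩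
  ∑[ i < n ] (∑[ j < n ] up i j + ∑[ j < n ] up j i)
    ≡⟨ ∑-distrib-+ (λ i → ∑[ j < n ] up i j) (λ i → ∑[ j < n ] up j i) ⟩
  e + ∑[ i < n ] ∑[ j < n ] up j i                  ≡⟨ cong (e +_) (∑-comm (λ i j → up j i)) ⟩
  e + e                                             ≡⟨ cong₂ _+_ eJ≡e (trans (+-identityʳ (eJ J)) eJ≡e) ⟨
  2 * eJ J                                          ∎
  where
  open ≡-Reasoning
  lt : Fin n → Fin n → Bool
  lt i j = toℕ i <ᵇ toℕ j

  up : Fin n → Fin n → ℕ
  up i j = indicator (lt i j ∧ es J i j)

  e : ℕ
  e = ∑[ i < n ] ∑[ j < n ] up i j

  sum-of-counts : (E : Fin n → Fin n → Bool) →
                  sumFin (λ i → countFin (E i)) ≡ ∑[ i < n ] ∑[ j < n ] indicator (E i j)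
  sum-of-counts E = trans (sumFin-sum (λ i → countFin (E i))) (sum-cong-≗ (λ i → countFin-sum (E i)))

  eJ≡e : eJ J ≡ e
  eJ≡e = sum-of-counts (λ i j → lt i j ∧ es J i j)

  split : ∀ i j → indicator (es J i j) ≡ up i j + up j i
  split i j rewrite es-sym J j i with <-cmp (toℕ i) (toℕ j)
  ... | tri< i<j _ j≮i rewrite dec-true (toℕ i <? toℕ j) i<j | dec-false (toℕ j <? toℕ i) j≮i =
    sym (+-identityʳ _)
  ... | tri> i≮j _ j<i rewrite dec-false (toℕ i <? toℕ j) i≮j | dec-true (toℕ j <? toℕ i) j<i = refl
  ... | tri≈ _ i≡j _ with refl ← toℕ-injective i≡j
    rewrite es-irrefl J i | ∧-zeroʳ (lt i i) = refl

Degenerate : Graph n → ℕ → Set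
Degenerate {n} G d = ∀ (A : Fin n → Bool) x → A x ≡ true →
                     ∃ λ v → A v ≡ true × degree (G [ A ]) v ≤ d

mBelow⇒degenerate : (G : Graph n) (d : ℕ) → mBelow G (suc d) 2 → Degenerate G d
mBelow⇒degenerate G d sparse A x Ax
  with any? (λ v → (A v Data.Bool.≟ true) ×-dec (degree (G [ A ]) v ≤? d))
... | yes low = low
... | no ∄low = ⊥-elim (≤⇒≯ degree-sum≥ (sparse J (countFin>0 A Ax)))
  where
  J = inducedSubgraph G A
  degree-sum≥ : suc d * vJ J ≤ 2 * eJ J
  degree-sum≥ = subst (suc d * vJ J ≤_) (handshake J)
    (*-countFin≤sumFin A (degree (G [ A ])) (suc d) (λ v Av → ≰⇒> (λ low → ∄low (v , Av , low))))

module Extension (G : Graph n) (A : Fin n → Bool) (v : Fin n)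
                 (D : Orientation (G [ remove A v ])) (out : Fin n → Bool) where

  N : Fin n → Bool
  N = adj (G [ A ]) v

  arc⁺ : Fin n → Fin n → Bool
  arc⁺ x y = if does (x ≟ v) then N y ∧ out y
             else if does (y ≟ v) then N x ∧ not (out x)
             else arc D x y

  arc⁺-from-v : ∀ y → arc⁺ v y ≡ N y ∧ out y
  arc⁺-from-v y rewrite dec-true (v ≟ v) refl = refl

  arc⁺-into-v : ∀ {x} → x ≢ v → arc⁺ x v ≡ N x ∧ not (out x)
  arc⁺-into-v {x} x≢v rewrite dec-false (x ≟ v) x≢v | dec-true (v ≟ v) refl = refl

  arc⁺-away : ∀ {x y} → x ≢ v → y ≢ v → arc⁺ x y ≡ arc D x y
  arc⁺-away {x} {y} x≢v y≢v rewrite dec-false (x ≟ v) x≢v | dec-false (y ≟ v) y≢v = refl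

  arc⁺-edge : ∀ i j → arc⁺ i j ≡ true → adj (G [ A ]) i j ≡ true
  arc⁺-edge i j e with i ≟ v | j ≟ v
  ... | yes refl | _        = ∧-conicalˡ _ _ e
  ... | no i≢v   | yes refl = trans (Graph.sym (G [ A ]) i v) (∧-conicalˡ _ _ e)
  ... | no i≢v   | no j≢v   = trans (sym (induced-remove G A i≢v j≢v)) (arc-edge D i j e)

  arc⁺-total : ∀ i j → adj (G [ A ]) i j ≡ true → (arc⁺ i j ≡ true) ⊎ (arc⁺ j i ≡ true)
  arc⁺-total i j e with i ≟ v | j ≟ v
  ... | yes refl | yes refl = ⊥-elim (no-loop (G [ A ]) v e)
  ... | yes refl | no j≢v   = ∧-true-or-∧-not e (out j)
  ... | no i≢v   | yes refl = ⊎-swap (∧-true-or-∧-not (trans (Graph.sym (G [ A ]) v i) e) (out i))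
  ... | no i≢v   | no j≢v   = arc-total D i j (trans (induced-remove G A i≢v j≢v) e)

  arc⁺-anti : ∀ i j → arc⁺ i j ≡ true → arc⁺ j i ≡ false
  arc⁺-anti i j e with i ≟ v | j ≟ v
  ... | yes refl | yes refl = ⊥-elim (no-loop (G [ A ]) v (∧-conicalˡ _ _ e))
  ... | yes refl | no j≢v   = exclusive (N j) (out j) e
    where
    exclusive : ∀ a b → a ∧ b ≡ true → a ∧ not b ≡ false
    exclusive true true _ = refl
  ... | no i≢v   | yes refl = exclusive (N i) (out i) e
    where
    exclusive : ∀ a b → a ∧ not b ≡ true → a ∧ b ≡ false
    exclusive true false _ = refl
  ... | no i≢v   | no j≢v   = arc-anti D i j e

  orientation : Orientation (G [ A ])
  orientation = record
    { arc = arc⁺ ; arc-edge = arc⁺-edge ; arc-total = arc⁺-total ; arc-anti = arc⁺-anti }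

arc-irreflexive : {G : Graph n} (D : Orientation G) (x : Fin n) → arc D x x ≡ false
arc-irreflexive {G = G} D x with arc D x x in e
... | true  = ⊥-elim (no-loop G x (arc-edge D x x e))
... | false = refl

module TTFreeExtension (G : Graph n) (A : Fin n → Bool) (v : Fin n)
    (k₂ : ℕ) (2≤k₂ : 2 ≤ k₂) (degree-v : degree (G [ A ]) v ≤ suc (suc k₂))
    (D : Orientation (G [ remove A v ])) (D-free : ¬ ContainsTT (suc (suc k₂)) D) where

  -- Here k = k₂ + 2.
  outdegree : Fin n → ℕ
  outdegree y = countFin (λ z → adj (G [ A ]) v z ∧ arc D y z)

  big : Fin n → Bool
  big y = does (k₂ ≤? outdegree y)

  open Extension G A v D big

  module TTCopy (f : Fin (suc (suc k₂)) → Fin n) (f-inj : Injective _≡_ _≡_ f)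
              (f-arc : ∀ a b → toℕ a < toℕ b → arc⁺ (f a) (f b) ≡ true) where

    module _ {p : Fin (suc (suc k₂))} (fp≡v : f p ≡ v) where

      f≢v : ∀ {b} → b ≢ p → f b ≢ v
      f≢v b≢p fb≡v = b≢p (f-inj (trans fb≡v (sym fp≡v)))

      arc-away : ∀ {a b} → a ≢ p → b ≢ p → toℕ a < toℕ b → arc D (f a) (f b) ≡ true
      arc-away a≢p b≢p a<b = trans (sym (arc⁺-away (f≢v a≢p) (f≢v b≢p))) (f-arc _ _ a<b)

      into-v : ∀ {b} → toℕ b < toℕ p → N (f b) ∧ not (big (f b)) ≡ true
      into-v {b} b<p = trans (sym (arc⁺-into-v (f≢v (λ { refl → <-irrefl refl b<p }))))
                             (subst (λ w → arc⁺ (f b) w ≡ true) fp≡v (f-arc b p b<p))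

      from-v : ∀ {b} → toℕ p < toℕ b → N (f b) ∧ big (f b) ≡ true
      from-v {b} p<b = trans (sym (arc⁺-from-v (f b)))
                             (subst (λ w → arc⁺ w (f b) ≡ true) fp≡v (f-arc p b p<b))

      f∈N : ∀ {b} → b ≢ p → N (f b) ≡ true
      f∈N {b} b≢p with <-cmpᶠ b p
      ... | tri< b<p _ _ = ∧-conicalˡ _ _ (into-v b<p)
      ... | tri≈ _ b≡p _ = ⊥-elim (b≢p b≡p)
      ... | tri> _ _ p<b = ∧-conicalˡ _ _ (from-v p<b)

    -- The last vertex t has all of f 1, …, f (k - 1) outside its out-neighbourhood, so it
    -- sends at most |N(v)| - (k - 1) ≤ 1 arcs into N(v); hence t → v, against v = f 0 → t.
    v-not-first : f fzero ≡ v → ⊥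
    v-not-first f0≡v =
      true≢false (trans (sym (∧-conicalʳ _ _ (from-v f0≡v {t} z<s)))
                        (dec-false (k₂ ≤? outdegree (f t)) small))
      where
      t : Fin (suc (suc k₂))
      t = fsuc (fromℕ k₂)

      not-out : ∀ c → arc D (f t) (f (fsuc c)) ≡ false
      not-out c with c ≟ fromℕ k₂
      ... | yes refl = arc-irreflexive D (f t)
      ... | no c≢last =
        arc-anti D _ _ (arc-away f0≡v (λ ()) (λ ()) (s<s (≤∧≢⇒<ᶠ (≤fromℕ c) c≢last)))

      small : ¬ k₂ ≤ outdegree (f t)
      small k₂≤out = ≤⇒≯ (+-cancelʳ-≤ (suc k₂) (outdegree (f t)) 1 (begin
        outdegree (f t) + suc k₂
          ≤⟨ +-monoʳ-≤ (outdegree (f t))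
               (injective⇒≤countFin (f ∘ fsuc) (suc-injective ∘ f-inj) _
                 (λ c → ∧-true (f∈N f0≡v (λ ())) (cong not (not-out c)))) ⟩
        outdegree (f t) + countFin (λ z → N z ∧ not (arc D (f t) z))
          ≡⟨ countFin-∧-not N (arc D (f t)) ⟨
        degree (G [ A ]) v
          ≤⟨ degree-v ⟩
        suc (suc k₂) ∎)) (≤-trans 2≤k₂ k₂≤out)
        where open ≤-Reasoning

    -- f 0 sends arcs to the k - 2 copy vertices other than itself and v, all in N(v);
    -- hence v → f 0, against f 0 → v.
    v-not-later : ∀ {p} → f (fsuc p) ≡ v → ⊥
    v-not-later {p} fp≡v =
      true≢false (trans (sym (dec-true (k₂ ≤? outdegree (f fzero)) many))
                        (not-injective (∧-conicalʳ _ _ (into-v fp≡v {fzero} z<s))))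
      where
      between : Fin k₂ → Fin (suc (suc k₂))
      between c = fsuc (punchIn p c)

      between≢p : ∀ c → between c ≢ fsuc p
      between≢p c = punchInᵢ≢i p c ∘ suc-injective

      many : k₂ ≤ outdegree (f fzero)
      many = injective⇒≤countFin (f ∘ between) (punchIn-injective p _ _ ∘ suc-injective ∘ f-inj) _
               (λ c → ∧-true (f∈N fp≡v (between≢p c)) (arc-away fp≡v (λ ()) (between≢p c) z<s))

  TT-free : ¬ ContainsTT (suc (suc k₂)) orientation
  TT-free (f , f-inj , f-arc) with any? (λ p → f p ≟ v)
  ... | yes (fzero  , f0≡v) = TTCopy.v-not-first f f-inj f-arc f0≡v
  ... | yes (fsuc p , fp≡v) = TTCopy.v-not-later f f-inj f-arc fp≡v
  ... | no v∉f = D-free (f , f-inj , λ a b a<b →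
                   trans (sym (arc⁺-away (λ e → v∉f (a , e)) (λ e → v∉f (b , e)))) (f-arc a b a<b))

TT-free-orientation-of-empty : {G : Graph n} (A : Fin n → Bool) → (∀ x → A x ≢ true) →
                   Σ (Orientation (G [ A ])) (λ D → ¬ ContainsTT (suc (suc m)) D)
TT-free-orientation-of-empty A empty =
  record { arc = λ _ _ → false ; arc-edge = λ _ _ () ; arc-total = no-edge ; arc-anti = λ _ _ () }
  , λ (_ , _ , f-arc) → true≢false (sym (f-arc fzero (fsuc fzero) z<s))
  where
  no-edge : ∀ i j → _ ≡ true → _
  no-edge i j e = ⊥-elim (empty i (∧-conicalˡ _ _ e))

module _ (G : Graph n) (k₂ : ℕ) (2≤k₂ : 2 ≤ k₂) (degenerate : Degenerate G (suc (suc k₂))) where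

  TT-free-orientation-on : ∀ m (A : Fin n → Bool) → countFin A ≤ m →
                           Σ (Orientation (G [ A ])) (λ D → ¬ ContainsTT (suc (suc k₂)) D)
  TT-free-orientation-on zero A |A|≤0 =
    TT-free-orientation-of-empty {G = G} A (λ x Ax → ≤⇒≯ |A|≤0 (countFin>0 A Ax))
  TT-free-orientation-on (suc m) A |A|≤ with any? (λ x → A x Data.Bool.≟ true)
  ... | no ∄x = TT-free-orientation-of-empty {G = G} A (λ x Ax → ∄x (x , Ax))
  ... | yes (x , Ax) with degenerate A x Ax
  ...   | v , Av , degree-v = Extension.orientation G A v D big , TT-free
    where
    recursive = TT-free-orientation-on m (remove A v)
                  (s≤s⁻¹ (subst (_≤ suc m) (countFin-remove A Av) |A|≤))
    D = proj₁ recursive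
    open TTFreeExtension G A v k₂ 2≤k₂ degree-v D (proj₂ recursive)

  degenerate⇒TT-free-orientation : Σ (Orientation G) (λ D → ¬ ContainsTT (suc (suc k₂)) D)
  degenerate⇒TT-free-orientation with TT-free-orientation-on _ (λ _ → true) ≤-refl
  ... | D , D-free =
    -- adj (G [ λ _ → true ]) reduces to adj G.
    record { arc = arc D ; arc-edge = arc-edge D ; arc-total = arc-total D ; arc-anti = arc-anti D }
    , D-free

theorem12 : ∀ (k : ℕ) → 4 ≤ k → ∀ (n : ℕ) (G : Graph n) →
    mBelow G (suc k) 2 → Σ (Orientation G) (λ D → ¬ ContainsTT k D)
theorem12 _ (s≤s (s≤s {n = k₂} 2≤k₂)) n G sparse =
  degenerate⇒TT-free-orientation G k₂ 2≤k₂ (mBelow⇒degenerate G (suc (suc k₂)) sparse)
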